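{- Let $(\Gamma,g)$ be a vertex-weighted metric graph of genus $g(\Gamma)$, and let $F$ be a tropical meromorphic function on $\Gamma$ with $\operatorname{div}(F)+K_\Gamma\geq 0$. Then for every $x\in\Gamma$ and every tangent direction $v$ at $x$, $|d_vF(x)|\leq 2g(\Gamma)-1$. If $K_\Gamma$ is effective (i.e., $\Gamma$ has no genus-zero leaves), then $|d_vF(x)|\leq 2g(\Gamma)-2$.
   Context: A vertex-weighted metric graph is a finite connected metric graph with finitely many vertices each carrying a weight $g(x)\in\mathbb{Z}_{\geq 0}$; non-vertex points have weight $0$ and valency $\deg(x)=2$. Genus: $g(\Gamma)=h_1(\Gamma)+\sum_xg(x)$. Canonical divisor: $K_\Gamma=\sum_{x}(2g(x)-2+\deg(x))(x)$. A genus-zero leaf is a vertex of weight $0$ and valency $1$. A tropical meromorphic function is a continuous piecewise affine function $F\colon\Gamma\to\mathbb{R}$ with integer slopes; $d_vF(x)$ is its outgoing slope at $x$ in direction $v$; $\operatorname{div}(F)=\sum_x\operatorname{ord}_x(F)(x)$ with $\operatorname{ord}_x(F)=-\sum_{v}d_vF(x)$ (sum over tangent directions at $x$).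
   Formalization: The edge lengths of Γ and the values of F are rational instead of real. -}

module Defs where

open import Data.Nat as ℕ using (ℕ; zero; suc)
open import Data.Fin using (Fin; zero; suc)
open import Data.Bool using (Bool; true; false; if_then_else_)
open import Data.Product using (_×_; _,_; Σ)
open import Relation.Binary.PropositionalEquality using (_≡_)
open import Relation.Nullary.Decidable using (⌊_⌋)
open import Data.Fin using (_≟_)
open import Data.Integer as ℤ using (ℤ; +_)
import Data.Rational as ℚ
open ℚ using (ℚ)

sumFin : {k : ℕ} → (Fin k → ℤ) → ℤ
sumFin {zero}  f = + 0
sumFin {suc k} f = f zero ℤ.+ sumFin (λ i → f (suc i))

toℚ : ℤ → ℚ
toℚ z = z ℚ./ 1

-- A (model of a) vertex-weighted metric graph: vertices Fin n, edges Fin m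
-- (multi-edges and loops allowed), edge e goes from src e to tgt e and has
-- a positive rational length len e; each vertex carries a weight wt.

record WGraph : Set where
  field
    n m   : ℕ
    src   : Fin m → Fin n
    tgt   : Fin m → Fin n
    wt    : Fin n → ℕ
    len   : Fin m → ℚ
    len-pos : (e : Fin m) → ℚ.0ℚ ℚ.< len e

module _ (G : WGraph) where
  open WGraph G

  data Reach : Fin n → Fin n → Set where
    here : ∀ {x} → Reach x x
    fwd  : ∀ {x} (e : Fin m) → Reach (tgt e) x → Reach (src e) x
    bwd  : ∀ {x} (e : Fin m) → Reach (src e) x → Reach (tgt e) x

  Connected : Set
  Connected = Fin n × ((x y : Fin n) → Reach x y)

  -- genus g(Γ) = h₁(Γ) + Σ g(x), with h₁ = m − n + 1 for a connected graph
  genus : ℤ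
  genus = ((+ m) ℤ.- (+ n)) ℤ.+ + 1 ℤ.+ sumFin (λ x → + wt x)

  [_≡ᵥ_] : Fin n → Fin n → ℤ
  [ x ≡ᵥ y ] = if ⌊ x ≟ y ⌋ then + 1 else + 0

  -- valency: number of edge-ends at x (a loop counts twice)
  deg : Fin n → ℤ
  deg x = sumFin (λ e → [ src e ≡ᵥ x ] ℤ.+ [ tgt e ≡ᵥ x ])

  K : Fin n → ℤ
  K x = (+ 2 ℤ.* + wt x ℤ.- + 2) ℤ.+ deg x

  -- tangent directions: an edge together with which end (false = src, true = tgt)
  Dir : Set
  Dir = Fin m × Bool

  base : Dir → Fin n
  base (e , false) = src e
  base (e , true)  = tgt e

  -- A tropical meromorphic function, given on this model: values at vertices,
  -- affine on each edge with integer slope (slope measured from src to tgt).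
  record TropFun : Set where
    field
      F      : Fin n → ℚ
      slope  : Fin m → ℤ
      affine : (e : Fin m) → F (tgt e) ℚ.- F (src e) ≡ toℚ (slope e) ℚ.* len e

  module _ (φ : TropFun) where
    open TropFun φ

    -- outgoing slope d_v F(x) at x = base v in direction v
    dslope : Dir → ℤ
    dslope (e , false) = slope e
    dslope (e , true)  = ℤ.- slope e

    -- ord_x(F) = − Σ_v d_v F(x)
    ord : Fin n → ℤ
    ord x = ℤ.- sumFin (λ e → (if ⌊ src e ≟ x ⌋ then slope e else + 0)
                              ℤ.+ (if ⌊ tgt e ≟ x ⌋ then ℤ.- slope e else + 0))

-- Sum the hypothesis ord + K ≥ 0 over a set P of vertices.  Writing Γ[P] for the induced
-- subgraph, the sum is deg K_Γ[P] minus the sum of d_vF − 1 over the directions v that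
-- point out of P along the edges leaving P.  On a sublevel set P = {F ≤ a} each such d_vF
-- is positive, so every term is ≥ 0 and an edge e leaving P gives |d_eF| ≤ deg K_Γ[P] + 1.
-- If Γ is connected and P nonempty then deg K_Γ[P] ≤ 2g − 2: adding to P the outer end x of
-- an edge leaving P adds 2g(x) − 2 ≥ −2 at x and at least 2 for the edge that becomes
-- interior, and deg K_Γ = 2g − 2.  If K_Γ ≥ 0, then deg K_Γ[P] + #(edges leaving P) is the
-- sum of K_Γ over P, hence ≤ 2g − 2, which saves one more unit.  An edge of nonzero slope
-- leaves the sublevel set of its lower end; for slope 0 it suffices that g ≥ 1 (take P = Γ).

module Submission where

open import Defs
open import Data.Product using (_×_)
open import Data.Integer using (ℤ; +_; _≤_; _-_; _+_; _*_; ∣_∣)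

import Algebra.Properties.Group as GroupProperties
open import Data.Bool using (Bool; true; false; if_then_else_; _∧_; _∨_; _xor_)
open import Data.Bool.Properties using (∨-zeroʳ; ¬-not) renaming (_≟_ to _≟ᵇ_)
open import Data.Fin using (Fin; zero; suc; _≟_)
open import Data.Fin.Properties using (all?; ¬∀⟶∃¬)
open import Data.Integer as ℤ using (-_; _<_; -[1+_])
import Data.Integer.Properties as ℤP
open import Data.Integer.Tactic.RingSolver using (solve-∀)
open import Data.Nat as ℕ using (ℕ; zero; suc)
import Data.Nat.Properties as ℕP
open import Data.Nat.Induction using (<-wellFounded)
open import Data.Product using (_,_; ∃; proj₁; proj₂)
import Data.Rational as ℚ
open ℚ using (ℚ; 0ℚ)
import Data.Rational.Properties as ℚP
open import Function using (_on_)
open import Induction.WellFounded using (Acc; acc)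
open import Relation.Binary.Construct.On using (wellFounded)
open import Relation.Binary.Definitions using (tri<; tri≈; tri>)
open import Relation.Binary.PropositionalEquality
open import Relation.Nullary using (¬_; Dec; contradiction)
open import Relation.Nullary.Decidable using (⌊_⌋; does; yes; no; dec-true; dec-false; isYes≗does)

open import Algebra.Properties.CommutativeMonoid.Sum ℤP.+-0-commutativeMonoid
  using (sum; sum-cong-≗; ∑-distrib-+; ∑-comm; sum-replicate-zero)
open import Algebra.Properties.Semiring.Sum ℤP.+-*-semiring using (*-distribˡ-sum)

module ℚ-Group = GroupProperties ℚP.+-0-group

-- z times the indicator of b, written as in Defs so that deg and ord unfold to sums of it.
when : Bool → ℤ → ℤ
when b z = if b then z else + 0

when-+ : ∀ b x y → when b (x + y) ≡ when b x + when b y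
when-+ true  x y = refl
when-+ false x y = refl

when-neg : ∀ b x → when b (- x) ≡ - when b x
when-neg true  x = refl
when-neg false x = refl

when-comm : ∀ b c x → when b (when c x) ≡ when c (when b x)
when-comm true  c     x = refl
when-comm false true  x = refl
when-comm false false x = refl

when-nonneg : ∀ b {x} → + 0 ≤ x → + 0 ≤ when b x
when-nonneg true  0≤x = 0≤x
when-nonneg false _   = ℤP.≤-refl

when-≤ : ∀ b {x} → + 0 ≤ x → when b x ≤ x
when-≤ true  _   = ℤP.≤-refl
when-≤ false 0≤x = 0≤x

when-mono : ∀ {b c} → (b ≡ true → c ≡ true) → ∀ {x} → + 0 ≤ x → when b x ≤ when c x
when-mono {true}      b⇒c _   rewrite b⇒c refl = ℤP.≤-refl
when-mono {false} {c} _   0≤x = when-nonneg c 0≤x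

-- Finite sums

sumFin≡sum : ∀ {k} (f : Fin k → ℤ) → sumFin f ≡ sum f
sumFin≡sum {zero}  f = refl
sumFin≡sum {suc k} f = cong (_+_ (f zero)) (sumFin≡sum (λ i → f (suc i)))

sum-mono-≤ : ∀ {k} {f g : Fin k → ℤ} → (∀ i → f i ≤ g i) → sum f ≤ sum g
sum-mono-≤ {zero}  _   = ℤP.≤-refl
sum-mono-≤ {suc k} f≤g = ℤP.+-mono-≤ (f≤g zero) (sum-mono-≤ (λ i → f≤g (suc i)))

sum-nonneg : ∀ {k} {f : Fin k → ℤ} → (∀ i → + 0 ≤ f i) → + 0 ≤ sum f
sum-nonneg {zero}  _   = ℤP.≤-refl
sum-nonneg {suc k} 0≤f = ℤP.+-mono-≤ (0≤f zero) (sum-nonneg (λ i → 0≤f (suc i)))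

term≤sum : ∀ {k} {f : Fin k → ℤ} → (∀ i → + 0 ≤ f i) → ∀ j → f j ≤ sum f
term≤sum {suc k} {f} 0≤f zero =
  subst (_≤ sum f) (ℤP.+-identityʳ (f zero)) (ℤP.+-monoʳ-≤ (f zero) (sum-nonneg (λ i → 0≤f (suc i))))
term≤sum {suc k} {f} 0≤f (suc j) =
  ℤP.≤-trans (term≤sum (λ i → 0≤f (suc i)) j)
             (subst (_≤ sum f) (ℤP.+-identityˡ _) (ℤP.+-monoˡ-≤ _ (0≤f zero)))

∑-const : ∀ k z → sum {k} (λ _ → z) ≡ + k * z
∑-const zero    z = sym (ℤP.*-zeroˡ z)
∑-const (suc k) z = begin
  z + sum {k} (λ _ → z)  ≡⟨ cong₂ _+_ (sym (ℤP.*-identityˡ z)) (∑-const k z) ⟩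
  + 1 * z + + k * z      ≡⟨ ℤP.*-distribʳ-+ z (+ 1) (+ k) ⟨
  + suc k * z            ∎
  where open ≡-Reasoning

∑-neg : ∀ {k} (f : Fin k → ℤ) → sum (λ i → - f i) ≡ - sum f
∑-neg {zero}  f = refl
∑-neg {suc k} f =
  trans (cong (_+_ (- f zero)) (∑-neg (λ i → f (suc i)))) (sym (ℤP.neg-distrib-+ (f zero) _))

∑-sub : ∀ {k} (f g : Fin k → ℤ) → sum (λ i → f i - g i) ≡ sum f - sum g
∑-sub f g = trans (∑-distrib-+ f (λ i → - g i)) (cong (_+_ (sum f)) (∑-neg g))

∑-when-+ : ∀ {k} (Q : Fin k → Bool) (f g : Fin k → ℤ) →
  sum (λ x → when (Q x) (f x + g x)) ≡ sum (λ x → when (Q x) (f x)) + sum (λ x → when (Q x) (g x))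
∑-when-+ Q f g = trans (sum-cong-≗ (λ x → when-+ (Q x) (f x) (g x)))
                       (∑-distrib-+ (λ x → when (Q x) (f x)) (λ x → when (Q x) (g x)))

when-sum : ∀ b {k} (f : Fin k → ℤ) → when b (sum f) ≡ sum (λ i → when b (f i))
when-sum true      f = refl
when-sum false {k} f = sym (sum-replicate-zero k)

-- Stated with does rather than ⌊_⌋ = isYes: only does (suc y ≟ suc x) reduces to does (y ≟ x).
∑-δ : ∀ {k} (y : Fin k) (f : Fin k → ℤ) → sum (λ x → when (does (y ≟ x)) (f x)) ≡ f y
∑-δ {suc k} zero    f = trans (cong (_+_ (f zero)) (sum-replicate-zero k)) (ℤP.+-identityʳ (f zero))
∑-δ {suc k} (suc y) f = trans (ℤP.+-identityˡ _) (∑-δ y (λ x → f (suc x)))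

∑-fibre : ∀ {k l} (π : Fin l → Fin k) (Q : Fin k → Bool) (a : Fin l → ℤ) →
  sum (λ x → when (Q x) (sum (λ e → when ⌊ π e ≟ x ⌋ (a e)))) ≡ sum (λ e → when (Q (π e)) (a e))
∑-fibre π Q a = begin
  sum (λ x → when (Q x) (sum (λ e → when ⌊ π e ≟ x ⌋ (a e))))
    ≡⟨ sum-cong-≗ (λ x → when-sum (Q x) (λ e → when ⌊ π e ≟ x ⌋ (a e))) ⟩
  sum (λ x → sum (λ e → when (Q x) (when ⌊ π e ≟ x ⌋ (a e))))
    ≡⟨ ∑-comm (λ x e → when (Q x) (when ⌊ π e ≟ x ⌋ (a e))) ⟩
  sum (λ e → sum (λ x → when (Q x) (when ⌊ π e ≟ x ⌋ (a e))))
    ≡⟨ sum-cong-≗ (λ e → trans (sum-cong-≗ (λ x → trans (when-comm (Q x) _ (a e))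
                                                       (cong (λ b → when b _) (isYes≗does (π e ≟ x)))))
                               (∑-δ (π e) (λ x → when (Q x) (a e)))) ⟩
  sum (λ e → when (Q (π e)) (a e))
    ∎
  where open ≡-Reasoning

insert : ∀ {k} → Fin k → (Fin k → Bool) → Fin k → Bool
insert z P x = does (z ≟ x) ∨ P x

insert-self : ∀ {k} (z : Fin k) {b} → does (z ≟ z) ∨ b ≡ true
insert-self z {b} = cong (_∨ b) (dec-true (z ≟ z) refl)

insert-mono : ∀ {k} {P : Fin k → Bool} z {x} → P x ≡ true → insert z P x ≡ true
insert-mono z Px = trans (cong (does (z ≟ _) ∨_) Px) (∨-zeroʳ _)

∑-insert : ∀ {k} (P : Fin k → Bool) {z} → P z ≡ false → (f : Fin k → ℤ) →
  sum (λ x → when (insert z P x) (f x)) ≡ f z + sum (λ x → when (P x) (f x))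
∑-insert P {z} Pz f =
  trans (sum-cong-≗ split)
        (trans (∑-distrib-+ (λ x → when (does (z ≟ x)) (f x)) (λ x → when (P x) (f x)))
               (cong (_+ sum (λ x → when (P x) (f x))) (∑-δ z f)))
  where
  split : ∀ x → when (insert z P x) (f x) ≡ when (does (z ≟ x)) (f x) + when (P x) (f x)
  split x with z ≟ x
  ... | yes refl rewrite Pz = sym (ℤP.+-identityʳ (f z))
  ... | no _ = sym (ℤP.+-identityˡ _)

outside : ∀ {k} → (Fin k → Bool) → ℕ
outside {zero}  P = 0
outside {suc k} P = (if P zero then 0 else 1) ℕ.+ outside (λ i → P (suc i))

outside-insert : ∀ {k} (P : Fin k → Bool) {z} → P z ≡ false → outside (insert z P) ℕ.< outside P
outside-insert P {zero}  Pz rewrite Pz = ℕP.n<1+n _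
outside-insert P {suc z} Pz = ℕP.+-monoʳ-< _ (outside-insert (λ i → P (suc i)) Pz)

-- Signs of slopes

toℚ-pos*pos⇒pos : ∀ {s l} → + 0 < s → 0ℚ ℚ.< l → 0ℚ ℚ.< toℚ s ℚ.* l
toℚ-pos*pos⇒pos {+ zero}  (ℤ.+<+ ()) _
toℚ-pos*pos⇒pos {+ suc k} {l} _ 0<l =
  ℚP.positive⁻¹ _ {{ℚP.pos*pos⇒pos (toℚ (+ suc k)) {{ℚP.normalize-pos (suc k) 1}}
                                    l {{ℚ.positive 0<l}}}}

toℚ-neg*pos⇒neg : ∀ {s l} → s < + 0 → 0ℚ ℚ.< l → toℚ s ℚ.* l ℚ.< 0ℚ
toℚ-neg*pos⇒neg {+ _}      (ℤ.+<+ ()) _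
toℚ-neg*pos⇒neg { -[1+ k ]} {l} _ 0<l =
  ℚP.negative⁻¹ _ {{ℚP.neg*pos⇒neg (toℚ -[1+ k ])
                      {{ℚP.neg-pos {ℚ.normalize (suc k) 1} (ℚP.normalize-pos (suc k) 1)}}
                      l {{ℚ.positive 0<l}}}}

<⇒≱ : ∀ {p q} → p ℚ.< q → ¬ (q ℚ.≤ p)
<⇒≱ p<q q≤p = ℚP.<-irrefl refl (ℚP.<-≤-trans p<q q≤p)

module SlopeSign {a b l : ℚ} {s : ℤ} (0<l : 0ℚ ℚ.< l) (rise : b ℚ.- a ≡ toℚ s ℚ.* l) where

  positive⇒ascending : + 0 < s → a ℚ.< b
  positive⇒ascending 0<s =
    subst₂ ℚ._<_ (ℚP.+-identityˡ a) (ℚ-Group.//-rightDividesˡ a b)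
      (ℚP.+-monoˡ-< a (subst (0ℚ ℚ.<_) (sym rise) (toℚ-pos*pos⇒pos 0<s 0<l)))

  negative⇒descending : s < + 0 → b ℚ.< a
  negative⇒descending s<0 =
    subst₂ ℚ._<_ (ℚ-Group.//-rightDividesˡ a b) (ℚP.+-identityˡ a)
      (ℚP.+-monoˡ-< a (subst (ℚ._< 0ℚ) (sym rise) (toℚ-neg*pos⇒neg s<0 0<l)))

  private
    zero⇒level : s ≡ + 0 → b ≡ a
    zero⇒level refl = ℚ-Group.x∙y⁻¹≈ε⇒x≈y b a (trans rise (ℚP.*-zeroˡ l))

  ascending⇒positive : a ℚ.< b → + 0 < s
  ascending⇒positive a<b with ℤP.<-cmp (+ 0) s
  ... | tri< 0<s _ _ = 0<s
  ... | tri≈ _ 0≡s _ = contradiction a<b (ℚP.<-irrefl (sym (zero⇒level (sym 0≡s))))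
  ... | tri> _ _ s<0 = contradiction a<b (ℚP.<-asym (negative⇒descending s<0))

  descending⇒negative : b ℚ.< a → s < + 0
  descending⇒negative b<a with ℤP.<-cmp (+ 0) s
  ... | tri< 0<s _ _ = contradiction b<a (ℚP.<-asym (positive⇒ascending 0<s))
  ... | tri≈ _ 0≡s _ = contradiction b<a (ℚP.<-irrefl (zero⇒level (sym 0≡s)))
  ... | tri> _ _ s<0 = s<0

-- Induced subgraphs

Effective : ∀ {k} → (Fin k → ℤ) → Set
Effective D = ∀ x → + 0 ≤ D x

noncrossing-outflow : ∀ p q s → p xor q ≡ false → when p s + when q (- s) ≡ + 0
noncrossing-outflow true  true  s _ = ℤP.+-inverseʳ s
noncrossing-outflow false false s _ = refl

crossing-∣outflow∣ : ∀ p q s → p xor q ≡ true → ∣ when p s + when q (- s) ∣ ≡ ∣ s ∣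
crossing-∣outflow∣ true  false s _ = cong ∣_∣ (ℤP.+-identityʳ s)
crossing-∣outflow∣ false true  s _ = trans (cong ∣_∣ (ℤP.+-identityˡ (- s))) (ℤP.∣-i∣≡∣i∣ s)

ends-split : ∀ p q → when p (+ 1) + when q (+ 1) ≡ when (p ∧ q) (+ 2) + when (p xor q) (+ 1)
ends-split true  true  = refl
ends-split true  false = refl
ends-split false true  = refl
ends-split false false = refl

module _ (G : WGraph) where
  open WGraph G

  interior crossing : (Fin n → Bool) → Fin m → Bool
  interior P e = P (src e) ∧ P (tgt e)
  crossing P e = P (src e) xor P (tgt e)

  #crossing : (Fin n → Bool) → ℤ
  #crossing P = sum (λ e → when (crossing P e) (+ 1))

  -- K G x unfolds to K₀ x + deg G x.
  K₀ : Fin n → ℤ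
  K₀ x = + 2 * + wt x - + 2

  -- deg K of the subgraph Γ[P] induced on P, with the same weights: 2 g(Γ[P]) − 2 if it is connected.
  inducedDegK : (Fin n → Bool) → ℤ
  inducedDegK P = sum (λ x → when (P x) (K₀ x)) + sum (λ e → when (interior P e) (+ 2))

  inducedDegK-cong : ∀ {P Q} → (∀ x → P x ≡ Q x) → inducedDegK P ≡ inducedDegK Q
  inducedDegK-cong P≗Q =
    cong₂ _+_ (sum-cong-≗ (λ x → cong (λ b → when b (K₀ x)) (P≗Q x)))
              (sum-cong-≗ (λ e → cong (λ b → when b (+ 2)) (cong₂ _∧_ (P≗Q (src e)) (P≗Q (tgt e)))))

  inducedDegK-all≡2g-2 : inducedDegK (λ _ → true) ≡ + 2 * genus G - + 2
  inducedDegK-all≡2g-2 = begin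
    sum K₀ + sum (λ (_ : Fin m) → + 2)
      ≡⟨ cong (_+ sum (λ (_ : Fin m) → + 2)) (∑-distrib-+ (λ x → + 2 * + wt x) (λ _ → - + 2)) ⟩
    (sum (λ x → + 2 * + wt x) + sum (λ (_ : Fin n) → - + 2)) + sum (λ (_ : Fin m) → + 2)
      ≡⟨ cong₂ _+_ (cong₂ _+_ (sym (*-distribˡ-sum (+ 2) (λ x → + wt x))) (∑-const n (- + 2)))
                   (∑-const m (+ 2)) ⟩
    (+ 2 * W + + n * - + 2) + + m * + 2
      ≡⟨ euler (+ m) (+ n) W ⟩
    + 2 * (((+ m - + n) + + 1) + W) - + 2
      ≡⟨ cong (λ w → + 2 * (((+ m - + n) + + 1) + w) - + 2) (sumFin≡sum (λ x → + wt x)) ⟨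
    + 2 * genus G - + 2
      ∎
    where
    open ≡-Reasoning
    W = sum (λ x → + wt x)
    euler : ∀ M N W → (+ 2 * W + N * - + 2) + M * + 2 ≡ + 2 * (((M - N) + + 1) + W) - + 2
    euler = solve-∀

  incidenceSum : (a b : Fin m → ℤ) → Fin n → ℤ
  incidenceSum a b x = sum (λ e → when ⌊ src e ≟ x ⌋ (a e) + when ⌊ tgt e ≟ x ⌋ (b e))

  deg≡incidenceSum : ∀ x → deg G x ≡ incidenceSum (λ _ → + 1) (λ _ → + 1) x
  deg≡incidenceSum x = sumFin≡sum (λ e → when ⌊ src e ≟ x ⌋ (+ 1) + when ⌊ tgt e ≟ x ⌋ (+ 1))

  ∑-incidenceSum : ∀ Q a b → sum (λ x → when (Q x) (incidenceSum a b x))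
                             ≡ sum (λ e → when (Q (src e)) (a e) + when (Q (tgt e)) (b e))
  ∑-incidenceSum Q a b = begin
    sum (λ x → when (Q x) (incidenceSum a b x))
      ≡⟨ sum-cong-≗ (λ x → cong (when (Q x)) (∑-distrib-+ (tail-terms x) (head-terms x))) ⟩
    sum (λ x → when (Q x) (sum (tail-terms x) + sum (head-terms x)))
      ≡⟨ ∑-when-+ Q (λ x → sum (tail-terms x)) (λ x → sum (head-terms x)) ⟩
    sum (λ x → when (Q x) (sum (tail-terms x))) + sum (λ x → when (Q x) (sum (head-terms x)))
      ≡⟨ cong₂ _+_ (∑-fibre src Q a) (∑-fibre tgt Q b) ⟩
    sum (λ e → when (Q (src e)) (a e)) + sum (λ e → when (Q (tgt e)) (b e))
      ≡⟨ ∑-distrib-+ (λ e → when (Q (src e)) (a e)) (λ e → when (Q (tgt e)) (b e)) ⟨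
    sum (λ e → when (Q (src e)) (a e) + when (Q (tgt e)) (b e))
      ∎
    where
    open ≡-Reasoning
    tail-terms head-terms : Fin n → Fin m → ℤ
    tail-terms x e = when ⌊ src e ≟ x ⌋ (a e)
    head-terms x e = when ⌊ tgt e ≟ x ⌋ (b e)

  ∑-K : ∀ P → sum (λ x → when (P x) (K G x)) ≡ inducedDegK P + #crossing P
  ∑-K P = begin
    sum (λ x → when (P x) (K₀ x + deg G x))
      ≡⟨ ∑-when-+ P K₀ (deg G) ⟩
    V + sum (λ x → when (P x) (deg G x))
      ≡⟨ cong (_+_ V) (trans (sum-cong-≗ (λ x → cong (when (P x)) (deg≡incidenceSum x)))
                             (∑-incidenceSum P _ _)) ⟩
    V + sum (λ e → when (P (src e)) (+ 1) + when (P (tgt e)) (+ 1))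
      ≡⟨ cong (_+_ V) (trans (sum-cong-≗ (λ e → ends-split (P (src e)) (P (tgt e))))
                             (∑-distrib-+ (λ e → when (interior P e) (+ 2))
                                          (λ e → when (crossing P e) (+ 1)))) ⟩
    V + (E + #crossing P)
      ≡⟨ ℤP.+-assoc V E (#crossing P) ⟨
    V + E + #crossing P
      ∎
    where
    open ≡-Reasoning
    V = sum (λ x → when (P x) (K₀ x))
    E = sum (λ e → when (interior P e) (+ 2))

  crossing-on-path : ∀ P {x y} → Reach G x y → P x ≡ true → P y ≡ false → ∃ λ e → crossing P e ≡ true
  crossing-on-path P here      Px   Py = contradiction (trans (sym Px) Py) λ ()
  crossing-on-path P (fwd e r) Psrc Py with P (tgt e) in Ptgt
  ... | true  = crossing-on-path P r Ptgt Py
  ... | false = e , cong₂ _xor_ Psrc Ptgt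
  crossing-on-path P (bwd e r) Ptgt Py with P (src e) in Psrc
  ... | true  = crossing-on-path P r Psrc Py
  ... | false = e , cong₂ _xor_ Psrc Ptgt

  crossing-inside : ∀ P e → crossing P e ≡ true → ∃ λ x → P x ≡ true
  crossing-inside P e cr with P (src e) in Psrc
  ... | true  = src e , Psrc
  ... | false = tgt e , cr

  crossing-outside : ∀ P e → crossing P e ≡ true →
    ∃ λ z → P z ≡ false × interior P e ≡ false × interior (insert z P) e ≡ true
  crossing-outside P e cr with P (src e) in Psrc | P (tgt e) in Ptgt
  ... | true  | false = tgt e , Ptgt , refl , cong₂ _∧_ (∨-zeroʳ _) (insert-self (tgt e))
  ... | false | true  = src e , Psrc , refl , cong₂ _∧_ (insert-self (src e)) (∨-zeroʳ _)

  interior-mono : ∀ {P Q} → (∀ {x} → P x ≡ true → Q x ≡ true) →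
    ∀ e → interior P e ≡ true → interior Q e ≡ true
  interior-mono {P} P⊆Q e _ with P (src e) in Psrc | P (tgt e) in Ptgt
  ... | true | true = cong₂ _∧_ (P⊆Q Psrc) (P⊆Q Ptgt)

  interior-gain : ∀ P z e₀ → interior P e₀ ≡ false → interior (insert z P) e₀ ≡ true →
    sum (λ e → when (interior P e) (+ 2)) + + 2 ≤ sum (λ e → when (interior (insert z P) e) (+ 2))
  interior-gain P z e₀ int₀ int₀′ = begin
    sum (λ e → when (interior P e) (+ 2)) + + 2
      ≡⟨ cong (_+_ (sum (λ e → when (interior P e) (+ 2)))) (∑-δ e₀ (λ _ → + 2)) ⟨
    sum (λ e → when (interior P e) (+ 2)) + sum (λ e → when (does (e₀ ≟ e)) (+ 2))
      ≡⟨ ∑-distrib-+ (λ e → when (interior P e) (+ 2)) (λ e → when (does (e₀ ≟ e)) (+ 2)) ⟨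
    sum (λ e → when (interior P e) (+ 2) + when (does (e₀ ≟ e)) (+ 2))
      ≤⟨ sum-mono-≤ gain ⟩
    sum (λ e → when (interior (insert z P) e) (+ 2))
      ∎
    where
    open ℤP.≤-Reasoning
    gain : ∀ e → when (interior P e) (+ 2) + when (does (e₀ ≟ e)) (+ 2)
                 ≤ when (interior (insert z P) e) (+ 2)
    gain e with e₀ ≟ e
    ... | yes refl rewrite int₀ | int₀′ = ℤP.≤-refl
    ... | no _ = ℤP.≤-trans (ℤP.≤-reflexive (ℤP.+-identityʳ _))
                   (when-mono (interior-mono {P} {insert z P} (insert-mono {P = P} z) e) (ℤ.+≤+ ℕ.z≤n))

  K₀+2-nonneg : ∀ x → + 0 ≤ K₀ x + + 2
  K₀+2-nonneg x = subst (+ 0 ≤_) (trans (ℤP.pos-* 2 (wt x)) (sym (cancel (+ 2 * + wt x)))) (ℤ.+≤+ ℕ.z≤n)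
    where
    cancel : ∀ w → w - + 2 + + 2 ≡ w
    cancel = solve-∀

  inducedDegK-insert : ∀ P {z} e₀ → P z ≡ false → interior P e₀ ≡ false → interior (insert z P) e₀ ≡ true →
    inducedDegK P ≤ inducedDegK (insert z P)
  inducedDegK-insert P {z} e₀ Pz int₀ int₀′ = begin
    V + E                       ≡⟨ ℤP.+-identityˡ _ ⟨
    + 0 + (V + E)               ≤⟨ ℤP.+-monoˡ-≤ (V + E) (K₀+2-nonneg z) ⟩
    (K₀ z + + 2) + (V + E)      ≡⟨ shuffle (K₀ z) V E ⟩
    (K₀ z + V) + (E + + 2)      ≤⟨ ℤP.+-monoʳ-≤ (K₀ z + V) (interior-gain P z e₀ int₀ int₀′) ⟩
    (K₀ z + V) + E′             ≡⟨ cong (_+ E′) (∑-insert P Pz K₀) ⟨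
    inducedDegK (insert z P)    ∎
    where
    open ℤP.≤-Reasoning
    V = sum (λ x → when (P x) (K₀ x))
    E = sum (λ e → when (interior P e) (+ 2))
    E′ = sum (λ e → when (interior (insert z P) e) (+ 2))
    shuffle : ∀ k v e → (k + + 2) + (v + e) ≡ (k + v) + (e + + 2)
    shuffle = solve-∀

  inducedDegK≤2g-2 : Connected G → ∀ P {x₀} → P x₀ ≡ true → inducedDegK P ≤ + 2 * genus G - + 2
  inducedDegK≤2g-2 (_ , reach) P {x₀} = grow P (wellFounded outside <-wellFounded P)
    where
    grow : ∀ P → Acc (ℕ._<_ on outside) P → P x₀ ≡ true → inducedDegK P ≤ + 2 * genus G - + 2
    grow P (acc smaller) Px₀ with all? (λ x → P x ≟ᵇ true)
    ... | yes all-in = ℤP.≤-reflexive (trans (inducedDegK-cong all-in) inducedDegK-all≡2g-2)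
    ... | no ¬all-in with ¬∀⟶∃¬ n (λ x → P x ≡ true) (λ x → P x ≟ᵇ true) ¬all-in
    ... | y , Py≢true with crossing-on-path P (reach x₀ y) Px₀ (¬-not Py≢true)
    ... | e , cr with crossing-outside P e cr
    ... | z , Pz , int , int′ =
      ℤP.≤-trans (inducedDegK-insert P e Pz int int′)
                 (grow (insert z P) (smaller (outside-insert P Pz)) (insert-mono {P = P} z Px₀))

  inducedDegK+1≤2g-2 : Effective (K G) → ∀ P {e} → crossing P e ≡ true →
    inducedDegK P + + 1 ≤ + 2 * genus G - + 2
  inducedDegK+1≤2g-2 K≥0 P {e} cr = begin
    inducedDegK P + + 1
      ≤⟨ ℤP.+-monoʳ-≤ (inducedDegK P) one≤#crossing ⟩
    inducedDegK P + #crossing P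
      ≡⟨ ∑-K P ⟨
    sum (λ x → when (P x) (K G x))
      ≤⟨ sum-mono-≤ (λ x → when-≤ (P x) (K≥0 x)) ⟩
    sum (K G)
      ≡⟨ ∑-K (λ _ → true) ⟩
    inducedDegK (λ _ → true) + sum (λ (_ : Fin m) → + 0)
      ≡⟨ trans (cong (_+_ (inducedDegK (λ _ → true))) (sum-replicate-zero m)) (ℤP.+-identityʳ _) ⟩
    inducedDegK (λ _ → true)
      ≡⟨ inducedDegK-all≡2g-2 ⟩
    + 2 * genus G - + 2
      ∎
    where
    open ℤP.≤-Reasoning
    one≤#crossing : + 1 ≤ #crossing P
    one≤#crossing = subst (λ b → when b (+ 1) ≤ #crossing P) cr
                          (term≤sum (λ e → when-nonneg (crossing P e) (ℤ.+≤+ ℕ.z≤n)) e)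

  ≤2g-2+1⇒≤2g-1 : ∀ {i} → i ≤ (+ 2 * genus G - + 2) + + 1 → i ≤ + 2 * genus G - + 1
  ≤2g-2+1⇒≤2g-1 = subst (_ ≤_) (shift (genus G))
    where
    shift : ∀ g → (+ 2 * g - + 2) + + 1 ≡ + 2 * g - + 1
    shift = solve-∀

  -- Slopes of F along edges leaving a vertex set

  module _ (φ : TropFun G) where
    open TropFun φ

    divF+K : Fin n → ℤ
    divF+K x = ord G φ x + K G x

    -- Sum of d_vF over the directions v along e based in P; slope e is measured from src to tgt.
    outflow : (Fin n → Bool) → Fin m → ℤ
    outflow P e = when (P (src e)) (slope e) + when (P (tgt e)) (- slope e)

    excess : (Fin n → Bool) → Fin m → ℤ
    excess P e = outflow P e - when (crossing P e) (+ 1)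

    ord≡-incidenceSum : ∀ x → ord G φ x ≡ - incidenceSum slope (λ e → - slope e) x
    ord≡-incidenceSum x =
      cong -_ (sumFin≡sum (λ e → when ⌊ src e ≟ x ⌋ (slope e) + when ⌊ tgt e ≟ x ⌋ (- slope e)))

    ∑-ord : ∀ P → sum (λ x → when (P x) (ord G φ x)) ≡ - sum (outflow P)
    ∑-ord P = begin
      sum (λ x → when (P x) (ord G φ x))
        ≡⟨ sum-cong-≗ (λ x → trans (cong (when (P x)) (ord≡-incidenceSum x)) (when-neg (P x) (Σslope x))) ⟩
      sum (λ x → - when (P x) (Σslope x))
        ≡⟨ ∑-neg (λ x → when (P x) (Σslope x)) ⟩
      - sum (λ x → when (P x) (Σslope x))
        ≡⟨ cong -_ (∑-incidenceSum P slope (λ e → - slope e)) ⟩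
      - sum (outflow P)
        ∎
      where
      open ≡-Reasoning
      Σslope : Fin n → ℤ
      Σslope = incidenceSum slope (λ e → - slope e)

    ∑-divF+K : ∀ P → sum (λ x → when (P x) (divF+K x)) ≡ inducedDegK P - sum (excess P)
    ∑-divF+K P = begin
      sum (λ x → when (P x) (ord G φ x + K G x))
        ≡⟨ ∑-when-+ P (ord G φ) (K G) ⟩
      sum (λ x → when (P x) (ord G φ x)) + sum (λ x → when (P x) (K G x))
        ≡⟨ cong₂ _+_ (∑-ord P) (∑-K P) ⟩
      - sum (outflow P) + (inducedDegK P + #crossing P)
        ≡⟨ rearrange (sum (outflow P)) (inducedDegK P) (#crossing P) ⟩
      inducedDegK P - (sum (outflow P) - #crossing P)
        ≡⟨ cong (_-_ (inducedDegK P)) (∑-sub (outflow P) (λ e → when (crossing P e) (+ 1))) ⟨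
      inducedDegK P - sum (excess P)
        ∎
      where
      open ≡-Reasoning
      rearrange : ∀ o a c → - o + (a + c) ≡ a - (o - c)
      rearrange = solve-∀

    ∑-excess≤ : Effective divF+K → ∀ P → sum (excess P) ≤ inducedDegK P
    ∑-excess≤ eff P =
      ℤP.0≤i-j⇒j≤i (subst (+ 0 ≤_) (∑-divF+K P) (sum-nonneg (λ x → when-nonneg (P x) (eff x))))

    IncreasingOutOf : (Fin n → Bool) → Set
    IncreasingOutOf P = ∀ e → crossing P e ≡ true → + 0 < outflow P e

    outflow-crossing : ∀ {P} → IncreasingOutOf P → ∀ e → crossing P e ≡ true → outflow P e ≡ + ∣ slope e ∣
    outflow-crossing {P} inc e cr =
      trans (sym (ℤP.0≤i⇒+∣i∣≡i (ℤP.<⇒≤ (inc e cr))))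
            (cong +_ (crossing-∣outflow∣ (P (src e)) (P (tgt e)) (slope e) cr))

    excess-nonneg : ∀ {P} → IncreasingOutOf P → ∀ e → + 0 ≤ excess P e
    excess-nonneg {P} inc e with crossing P e in cr
    ... | true  = ℤP.i≤j⇒0≤j-i (ℤP.i<j⇒suc[i]≤j (inc e cr))
    ... | false = ℤP.≤-reflexive (sym (trans (ℤP.+-identityʳ _)
                                         (noncrossing-outflow (P (src e)) (P (tgt e)) (slope e) cr)))

    crossing-slope-bound : Effective divF+K → ∀ {P} → IncreasingOutOf P →
      ∀ e → crossing P e ≡ true → + ∣ slope e ∣ ≤ inducedDegK P + + 1
    crossing-slope-bound eff {P} inc e cr = begin
      + ∣ slope e ∣          ≡⟨ outflow-crossing {P} inc e cr ⟨
      outflow P e            ≡⟨ excess+1 ⟨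
      excess P e + + 1       ≤⟨ ℤP.+-monoˡ-≤ (+ 1) (term≤sum (excess-nonneg {P} inc) e) ⟩
      sum (excess P) + + 1   ≤⟨ ℤP.+-monoˡ-≤ (+ 1) (∑-excess≤ eff P) ⟩
      inducedDegK P + + 1    ∎
      where
      open ℤP.≤-Reasoning
      cancel : ∀ o → o - + 1 + + 1 ≡ o
      cancel = solve-∀
      excess+1 : excess P e + + 1 ≡ outflow P e
      excess+1 = subst (λ b → outflow P e - when b (+ 1) + + 1 ≡ outflow P e) (sym cr)
                       (cancel (outflow P e))

    genus≥1 : Effective divF+K → + 0 ≤ + 2 * genus G - + 2
    genus≥1 eff = subst (+ 0 ≤_) inducedDegK-all≡2g-2
      (ℤP.≤-trans (sum-nonneg (excess-nonneg {λ _ → true} (λ _ ()))) (∑-excess≤ eff (λ _ → true)))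

    module Edge (e : Fin m) = SlopeSign {F (src e)} {F (tgt e)} {len e} {slope e} (len-pos e) (affine e)

    sublevel : ℚ → Fin n → Bool
    sublevel a x = does (F x ℚ.≤? a)

    sublevel-increasingOutOf : ∀ a → IncreasingOutOf (sublevel a)
    sublevel-increasingOutOf a e = leaving (F (src e) ℚ.≤? a) (F (tgt e) ℚ.≤? a)
      where
      open Edge e
      leaving : (src? : Dec (F (src e) ℚ.≤ a)) (tgt? : Dec (F (tgt e) ℚ.≤ a)) →
        does src? xor does tgt? ≡ true → + 0 < when (does src?) (slope e) + when (does tgt?) (- slope e)
      leaving (yes src≤a) (no tgt≰a) _ =
        subst (+ 0 <_) (sym (ℤP.+-identityʳ _))
          (ascending⇒positive (ℚP.≤-<-trans src≤a (ℚP.≰⇒> tgt≰a)))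
      leaving (no src≰a) (yes tgt≤a) _ =
        subst (+ 0 <_) (sym (ℤP.+-identityˡ _))
          (ℤP.neg-mono-< (descending⇒negative (ℚP.≤-<-trans tgt≤a (ℚP.≰⇒> src≰a))))

    nonzero-slope-crosses : ∀ e → slope e ≢ + 0 → ∃ λ a → crossing (sublevel a) e ≡ true
    nonzero-slope-crosses e s≢0 with ℤP.<-cmp (slope e) (+ 0)
    ... | tri< s<0 _ _ = F (tgt e) ,
      cong₂ _xor_ (dec-false (F (src e) ℚ.≤? F (tgt e)) (<⇒≱ (Edge.negative⇒descending e s<0)))
                  (dec-true (F (tgt e) ℚ.≤? F (tgt e)) ℚP.≤-refl)
    ... | tri≈ _ s≡0 _ = contradiction s≡0 s≢0
    ... | tri> _ _ 0<s = F (src e) ,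
      cong₂ _xor_ (dec-true (F (src e) ℚ.≤? F (src e)) ℚP.≤-refl)
                  (dec-false (F (tgt e) ℚ.≤? F (src e)) (<⇒≱ (Edge.positive⇒ascending e 0<s)))

    slope-bound : Connected G → Effective divF+K → ∀ e →
      (+ ∣ slope e ∣ ≤ + 2 * genus G - + 1) × (Effective (K G) → + ∣ slope e ∣ ≤ + 2 * genus G - + 2)
    slope-bound conn eff e with slope e ℤ.≟ + 0
    ... | yes s≡0 rewrite s≡0 =
      ≤2g-2+1⇒≤2g-1 (ℤP.≤-trans (genus≥1 eff) (ℤP.i≤i+j _ (+ 1))) , λ _ → genus≥1 eff
    ... | no s≢0 with nonzero-slope-crosses e s≢0
    ... | a , cr with crossing-inside (sublevel a) e cr
    ... | x₀ , Px₀ =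
      ≤2g-2+1⇒≤2g-1 (ℤP.≤-trans bound (ℤP.+-monoˡ-≤ (+ 1) (inducedDegK≤2g-2 conn (sublevel a) Px₀))) ,
      λ K≥0 → ℤP.≤-trans bound (inducedDegK+1≤2g-2 K≥0 (sublevel a) cr)
      where
      bound : + ∣ slope e ∣ ≤ inducedDegK (sublevel a) + + 1
      bound = crossing-slope-bound eff (sublevel-increasingOutOf a) e cr

∣dslope∣≡∣slope∣ : ∀ G φ (v : Dir G) → ∣ dslope G φ v ∣ ≡ ∣ TropFun.slope φ (proj₁ v) ∣
∣dslope∣≡∣slope∣ G φ (e , false) = refl
∣dslope∣≡∣slope∣ G φ (e , true)  = ℤP.∣-i∣≡∣i∣ (TropFun.slope φ e)

lemma4p8 : (G : WGraph) → Connected G → (φ : TropFun G)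
    → ((x : _) → + 0 ≤ ord G φ x + K G x)
    → ((v : Dir G) → + ∣ dslope G φ v ∣ ≤ + 2 * genus G - + 1)
      × (((x : _) → + 0 ≤ K G x) → (v : Dir G) → + ∣ dslope G φ v ∣ ≤ + 2 * genus G - + 2)
lemma4p8 G conn φ eff =
  (λ v → via v (proj₁ (slope-bound G φ conn eff (proj₁ v)))) ,
  (λ K≥0 v → via v (proj₂ (slope-bound G φ conn eff (proj₁ v)) K≥0))
  where
  via : ∀ {bound} v → + ∣ TropFun.slope φ (proj₁ v) ∣ ≤ bound → + ∣ dslope G φ v ∣ ≤ bound
  via v = subst (λ t → + t ≤ _) (sym (∣dslope∣≡∣slope∣ G φ v))
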